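{- Let $V$ be a set of $n$ vertices and $p$ an integer with $1\le p\le n-2$. There exists a $p$-Query-Scheme on $V$ of size $\mathcal{O}\big(p^3\log(n/p)\big)$.
   Context: A witness is a tuple $(\{u,v\},\{w_1,\dots,w_p\})$ of distinct vertices $u,v,w_1,\dots,w_p\in V$. A family $\mathcal{Q}=\{Q_1,\dots,Q_\ell\}$ of subsets of $V$ is a $p$-Query-Scheme of size $\ell$ if for every witness $(\{u,v\},\{w_1,\dots,w_p\})$ there is $i$ with $u,v\in Q_i$ and $\{w_1,\dots,w_p\}\cap Q_i=\emptyset$. -}

module Defs where

open import Data.Nat using (ℕ)
open import Data.Fin using (Fin)
open import Data.Fin.Subset using (Subset; _∈_; _∉_; ∣_∣)
open import Data.List using (List)
open import Data.List.Relation.Unary.Any using (Any)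
open import Data.Product using (_×_)
open import Relation.Binary.PropositionalEquality using (_≡_)
open import Relation.Nullary using (¬_)

IsWitness : {n : ℕ} → ℕ → Fin n → Fin n → Subset n → Set
IsWitness p u v W = ¬ (u ≡ v) × (∣ W ∣ ≡ p) × (u ∉ W) × (v ∉ W)

Separates : {n : ℕ} → Subset n → Fin n → Fin n → Subset n → Set
Separates Q u v W = (u ∈ Q) × (v ∈ Q) × (∀ w → w ∈ W → w ∉ Q)

IsQueryScheme : {n : ℕ} → ℕ → List (Subset n) → Set
IsQueryScheme {n} p 𝒬 =
  (u v : Fin n) (W : Subset n) → IsWitness p u v W →
  Any (λ Q → Separates Q u v W) 𝒬

{-# OPTIONS --safe #-}
-- If n² ≤ p³, the n² sets {u, v} already form a scheme of admissible size. Otherwise let Q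
-- contain each vertex independently with probability 1/(2p). A witness ({u, v}, W) is separated
-- by Q with probability at least P[u, v ∈ Q] − Σ_{w ∈ W} P[u, v, w ∈ Q] = (2p)⁻² − p (2p)⁻³
-- = 1/(8p²), so 8p²τ independent copies of Q all miss it with probability at most
-- (1 − 1/(8p²))^(8p²τ) ≤ 2^-τ. With 2^τ just above the number n^(p+2) of tuples
-- (u, v, w₁, …, w_p), the union bound leaves a family of 8p²τ = O(p³ log n) sets missing no
-- witness, and log n = O(log (n/p)) because p³ < n².
-- Probabilities are ratios of counts: Q ranges over the list of all vectors of coin outcomes
-- (one `true` among 2p per vertex), and events are Boolean predicates counted over that list.
module Submission where

open import Defs
open import Data.Nat using (ℕ; _+_; _*_; _^_; _≤_)
open import Data.Fin.Subset using (Subset)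
open import Data.List using (List; length)
open import Data.Product using (Σ; ∃; _×_; _,_)

open import Function using (_∘_; const; id)
open import Function.Bundles using (Equivalence)
open import Data.Bool using (Bool; true; false; _∧_; not; T)
open import Data.Bool.Properties using (T-∧; T-≡)
open import Data.Bool.ListAction using (any; all)
open import Data.Nat using (zero; suc; _<_; z≤n; s≤s; z<s; _≤?_; _<?_; NonZero; >-nonZero)
open import Data.Nat.Properties
open import Data.Nat.Tactic.RingSolver using (solve-∀)
open import Data.Fin using (Fin; zero; suc)
open import Data.Fin.Subset using (⁅_⁆; _∪_; _⊆_; _∉_; ∣_∣) renaming (_∈_ to _∈ₛ_)
open import Data.Fin.Subset.Properties
  using (_⊆?_; _∈?_; ∪-identityˡ; x∈p∪q⁻; x∈p∪q⁺; x∈⁅y⁆⇒x≡y; x∈⁅x⁆; ∣⁅x⁆∣≡1; x≢y⇒x∉⁅y⁆)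
open import Data.List using ([]; _∷_; _++_; map; replicate; filter; allFin; cartesianProductWith)
open import Data.List.Properties using (length-++; length-map; length-replicate; length-filter; length-tabulate)
open import Data.List.Membership.Propositional using (_∈_; lose)
open import Data.List.Membership.Propositional.Properties
  using (∈-map⁺; ∈-map⁻; ∈-cartesianProductWith⁺; ∈-filter⁺; ∈-filter⁻; ∈-allFin)
open import Data.List.Relation.Unary.All as All using (All; all?)
open import Data.List.Relation.Unary.Any as Any using (Any; here; there)
open import Data.List.Relation.Unary.Any.Properties using (any⁺)
open import Data.Vec as Vec using (Vec; []; _∷_; toList)
open import Data.Vec.Properties using (length-toList; toList-map)
open import Data.Product using (proj₁; proj₂)
open import Data.Sum using ([_,_]′; inj₁; inj₂)
open import Data.Empty using (⊥-elim)
open import Relation.Nullary using (¬_; Dec; yes; no; does; ¬?; _×-dec_)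
open import Relation.Nullary.Decidable using (dec-true)
open import Relation.Unary using (Decidable)
open import Relation.Binary.PropositionalEquality

private variable
  A B C : Set
  k n : ℕ

^-distribʳ-* : ∀ a b k → (a * b) ^ k ≡ a ^ k * b ^ k
^-distribʳ-* a b zero    = refl
^-distribʳ-* a b (suc k) = trans (cong (a * b *_) (^-distribʳ-* a b k)) (interchange a b (a ^ k) (b ^ k))
  where
  interchange : ∀ a b c d → a * b * (c * d) ≡ a * c * (b * d)
  interchange = solve-∀

^-mono-*-≤ : ∀ k {a b c} → a * b ≤ c → a ^ k * b ^ k ≤ c ^ k
^-mono-*-≤ k {a} {b} ab≤c = ≤-trans (≤-reflexive (sym (^-distribʳ-* a b k))) (^-monoˡ-≤ k ab≤c)

bernoulli : ∀ a b k → a ^ k * (a + k * b) ≤ (a + b) ^ k * a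
bernoulli a b zero    = ≤-reflexive (+-identityʳ (a + 0))
bernoulli a b (suc k) = begin
  a * a ^ k * (a + suc k * b)       ≡⟨ shuffle a (a ^ k) (suc k * b) ⟩
  a ^ k * (a * (a + suc k * b))     ≤⟨ *-monoʳ-≤ (a ^ k) step ⟩
  a ^ k * ((a + b) * (a + k * b))   ≡⟨ swap (a ^ k) (a + b) (a + k * b) ⟩
  (a + b) * (a ^ k * (a + k * b))   ≤⟨ *-monoʳ-≤ (a + b) (bernoulli a b k) ⟩
  (a + b) * ((a + b) ^ k * a)       ≡⟨ sym (*-assoc (a + b) _ a) ⟩
  (a + b) * (a + b) ^ k * a         ∎
  where
  open ≤-Reasoning
  shuffle : ∀ a c d → a * c * (a + d) ≡ c * (a * (a + d))
  shuffle = solve-∀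
  swap : ∀ c x y → c * (x * y) ≡ x * (c * y)
  swap = solve-∀
  expand : ∀ a b k → (a + b) * (a + k * b) ≡ a * (a + (1 + k) * b) + k * b * b
  expand = solve-∀
  step : a * (a + suc k * b) ≤ (a + b) * (a + k * b)
  step = ≤-trans (m≤m+n _ (k * b * b)) (≤-reflexive (sym (expand a b k)))

-- (1 − 1/K)^K ≤ 1/2, in the form: a ≤ M (1 − 1/K) implies a^K ≤ M^K / 2.
halving-power : ∀ K {a M} → 1 < K → a * K + M ≤ M * K → a ^ K * 2 ≤ M ^ K
halving-power (suc zero) (s≤s ())
halving-power K@(suc j@(suc _)) {a} {M} _ small = *-cancelʳ-≤ _ _ (j ^ K) {{m^n≢0 j K}} (begin
  a ^ K * 2 * j ^ K     ≡⟨ *-assoc (a ^ K) 2 (j ^ K) ⟩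
  a ^ K * (2 * j ^ K)   ≤⟨ *-monoʳ-≤ (a ^ K) 2j^K≤K^K ⟩
  a ^ K * K ^ K         ≤⟨ ^-mono-*-≤ K {a} {K} aK≤Mj ⟩
  (M * j) ^ K           ≡⟨ ^-distribʳ-* M j K ⟩
  M ^ K * j ^ K         ∎)
  where
  open ≤-Reasoning
  aK≤Mj : a * K ≤ M * j
  aK≤Mj = +-cancelʳ-≤ M (a * K) (M * j) (≤-trans small (≤-reflexive (trans (*-suc M j) (+-comm M (M * j)))))
  2j≤j+K : 2 * j ≤ j + K * 1
  2j≤j+K = ≤-trans (n≤1+n (2 * j)) (≤-reflexive (sym (j+K≡1+2j j)))
    where
    j+K≡1+2j : ∀ j → j + (1 + j) * 1 ≡ 1 + 2 * j
    j+K≡1+2j = solve-∀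
  2j^K≤K^K : 2 * j ^ K ≤ K ^ K
  2j^K≤K^K = *-cancelʳ-≤ _ _ j (begin
    2 * j ^ K * j       ≡⟨ rearrange (j ^ K) j ⟩
    j ^ K * (2 * j)     ≤⟨ *-monoʳ-≤ (j ^ K) 2j≤j+K ⟩
    j ^ K * (j + K * 1) ≤⟨ bernoulli j 1 K ⟩
    (j + 1) ^ K * j     ≡⟨ cong (λ x → x ^ K * j) (+-comm j 1) ⟩
    K ^ K * j           ∎)
    where
    rearrange : ∀ x j → 2 * x * j ≡ x * (2 * j)
    rearrange = solve-∀

power-of-two-between : ∀ N → 1 ≤ N → ∃ λ s → N < 2 ^ s × 2 ^ s ≤ 2 * N
power-of-two-between 1 _ = 1 , s≤s (s≤s z≤n) , ≤-refl
power-of-two-between (suc N@(suc _)) _ with power-of-two-between N (s≤s z≤n)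
... | s , N<2^s , 2^s≤2N with suc N <? 2 ^ s
...   | yes 1+N<2^s = s , 1+N<2^s , ≤-trans 2^s≤2N (*-monoʳ-≤ 2 (n≤1+n N))
...   | no  1+N≮2^s = suc s , subst (suc N <_) (sym 2^[1+s]≡2[1+N]) (m<m+n (suc N) z<s)
                            , ≤-reflexive 2^[1+s]≡2[1+N]
  where
  2^[1+s]≡2[1+N] : 2 * 2 ^ s ≡ 2 * suc N
  2^[1+s]≡2[1+N] = cong (2 *_) (≤-antisym (≮⇒≥ 1+N≮2^s) N<2^s)

-- Counting over finite lists

𝟙 : Bool → ℕ
𝟙 true  = 1
𝟙 false = 0

∑ : (A → ℕ) → List A → ℕ
∑ f []       = 0
∑ f (x ∷ xs) = f x + ∑ f xs

count : (A → Bool) → List A → ℕ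
count P = ∑ (𝟙 ∘ P)

module _ {f g : A → ℕ} where

  ∑-cong : ∀ xs → (∀ x → f x ≡ g x) → ∑ f xs ≡ ∑ g xs
  ∑-cong []       _   = refl
  ∑-cong (x ∷ xs) f≡g = cong₂ _+_ (f≡g x) (∑-cong xs f≡g)

  ∑-mono-≤ : ∀ xs → (∀ x → f x ≤ g x) → ∑ f xs ≤ ∑ g xs
  ∑-mono-≤ []       _   = z≤n
  ∑-mono-≤ (x ∷ xs) f≤g = +-mono-≤ (f≤g x) (∑-mono-≤ xs f≤g)

  ∑-+ : ∀ xs → ∑ (λ x → f x + g x) xs ≡ ∑ f xs + ∑ g xs
  ∑-+ []       = refl
  ∑-+ (x ∷ xs) = trans (cong (f x + g x +_) (∑-+ xs)) (+-exchange (f x) (g x) (∑ f xs) (∑ g xs))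
    where
    +-exchange : ∀ a b c d → a + b + (c + d) ≡ a + c + (b + d)
    +-exchange = solve-∀

∑-zero : (xs : List A) → ∑ (const 0) xs ≡ 0
∑-zero []       = refl
∑-zero (_ ∷ xs) = ∑-zero xs

∑-replicate : ∀ (f : A → ℕ) k x → ∑ f (replicate k x) ≡ k * f x
∑-replicate f zero    x = refl
∑-replicate f (suc k) x = cong (f x +_) (∑-replicate f k x)

∑-*ˡ : ∀ c (f : A → ℕ) xs → ∑ (λ x → c * f x) xs ≡ c * ∑ f xs
∑-*ˡ c f []       = sym (*-zeroʳ c)
∑-*ˡ c f (x ∷ xs) = trans (cong (c * f x +_) (∑-*ˡ c f xs)) (sym (*-distribˡ-+ c (f x) _))

∑-*ʳ : ∀ c (f : A → ℕ) xs → ∑ (λ x → f x * c) xs ≡ ∑ f xs * c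
∑-*ʳ c f []       = refl
∑-*ʳ c f (x ∷ xs) = trans (cong (f x * c +_) (∑-*ʳ c f xs)) (sym (*-distribʳ-+ c (f x) _))

∑-++ : ∀ (f : A → ℕ) xs ys → ∑ f (xs ++ ys) ≡ ∑ f xs + ∑ f ys
∑-++ f []       ys = refl
∑-++ f (x ∷ xs) ys = trans (cong (f x +_) (∑-++ f xs ys)) (sym (+-assoc (f x) _ _))

∑-map : ∀ (f : B → ℕ) (g : A → B) xs → ∑ f (map g xs) ≡ ∑ (f ∘ g) xs
∑-map f g []       = refl
∑-map f g (x ∷ xs) = cong (f (g x) +_) (∑-map f g xs)

∑-cartesianProductWith : ∀ (f : C → ℕ) (g : A → B → C) xs ys →
  ∑ f (cartesianProductWith g xs ys) ≡ ∑ (λ x → ∑ (f ∘ g x) ys) xs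
∑-cartesianProductWith f g []       ys = refl
∑-cartesianProductWith f g (x ∷ xs) ys = begin
  ∑ f (map (g x) ys ++ cartesianProductWith g xs ys)
    ≡⟨ ∑-++ f (map (g x) ys) _ ⟩
  ∑ f (map (g x) ys) + ∑ f (cartesianProductWith g xs ys)
    ≡⟨ cong₂ _+_ (∑-map f (g x) ys) (∑-cartesianProductWith f g xs ys) ⟩
  ∑ (f ∘ g x) ys + ∑ (λ x → ∑ (f ∘ g x) ys) xs ∎
  where open ≡-Reasoning

∑-comm : ∀ (f : A → B → ℕ) xs ys → ∑ (λ x → ∑ (f x) ys) xs ≡ ∑ (λ y → ∑ (λ x → f x y) xs) ys
∑-comm f []       ys = sym (∑-zero ys)
∑-comm f (x ∷ xs) ys = trans (cong (∑ (f x) ys +_) (∑-comm f xs ys)) (sym (∑-+ ys))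

∑-≤-length : ∀ (f : A → ℕ) c d xs → (∀ {x} → x ∈ xs → f x * c ≤ d) → ∑ f xs * c ≤ length xs * d
∑-≤-length f c d []       _     = z≤n
∑-≤-length f c d (x ∷ xs) bound = begin
  (f x + ∑ f xs) * c      ≡⟨ *-distribʳ-+ c (f x) (∑ f xs) ⟩
  f x * c + ∑ f xs * c    ≤⟨ +-mono-≤ (bound (here refl)) (∑-≤-length f c d xs (bound ∘ there)) ⟩
  d + length xs * d       ∎
  where open ≤-Reasoning

𝟙-∧ : ∀ a b → 𝟙 (a ∧ b) ≡ 𝟙 a * 𝟙 b
𝟙-∧ true  b = sym (+-identityʳ (𝟙 b))
𝟙-∧ false b = refl

count-∧ˡ : ∀ b (P : A → Bool) xs → count (λ x → b ∧ P x) xs ≡ 𝟙 b * count P xs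
count-∧ˡ b P xs = trans (∑-cong xs (λ x → 𝟙-∧ b (P x))) (∑-*ˡ (𝟙 b) (𝟙 ∘ P) xs)

𝟙-any≤∑ : ∀ (p : A → Bool) xs → 𝟙 (any p xs) ≤ ∑ (𝟙 ∘ p) xs
𝟙-any≤∑ p []       = z≤n
𝟙-any≤∑ p (x ∷ xs) with p x
... | true  = s≤s z≤n
... | false = 𝟙-any≤∑ p xs

𝟙-mono-≤ : ∀ {a b} → (T a → T b) → 𝟙 a ≤ 𝟙 b
𝟙-mono-≤ {false} _   = z≤n
𝟙-mono-≤ {true} {true}  _   = ≤-refl
𝟙-mono-≤ {true} {false} a⇒b = ⊥-elim (a⇒b _)

count-not : ∀ (P : A → Bool) xs → count (not ∘ P) xs + count P xs ≡ length xs
count-not P []       = refl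
count-not P (x ∷ xs) with P x
... | true  = trans (+-suc _ _) (cong suc (count-not P xs))
... | false = cong suc (count-not P xs)

count<length⇒∃¬ : ∀ (P : A → Bool) xs → count P xs < length xs → ∃ λ x → ¬ T (P x)
count<length⇒∃¬ P (x ∷ xs) lt with P x in eq
... | false = x , λ Px → subst T eq Px
... | true  = count<length⇒∃¬ P xs (≤-pred lt)

∃-avoiding : ∀ (Bad : B → A → Bool) ts xs c → 0 < length xs → length ts < c →
  (∀ {t} → t ∈ ts → count (Bad t) xs * c ≤ length xs) → ∃ λ x → ∀ {t} → t ∈ ts → ¬ T (Bad t x)
∃-avoiding Bad ts xs c nonempty few rare
  with count<length⇒∃¬ (λ x → any (λ t → Bad t x) ts) xs union<
  where
  open ≤-Reasoning
  sum< : ∑ (λ t → count (Bad t) xs) ts * c < length xs * c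
  sum< = begin-strict
    ∑ (λ t → count (Bad t) xs) ts * c   ≤⟨ ∑-≤-length _ c (length xs) ts rare ⟩
    length ts * length xs               <⟨ *-monoˡ-< (length xs) {{>-nonZero nonempty}} few ⟩
    c * length xs                       ≡⟨ *-comm c (length xs) ⟩
    length xs * c                       ∎
  union< : count (λ x → any (λ t → Bad t x) ts) xs < length xs
  union< = begin-strict
    count (λ x → any (λ t → Bad t x) ts) xs  ≤⟨ ∑-mono-≤ xs (λ x → 𝟙-any≤∑ (λ t → Bad t x) ts) ⟩
    ∑ (λ x → ∑ (λ t → 𝟙 (Bad t x)) ts) xs     ≡⟨ ∑-comm (λ x t → 𝟙 (Bad t x)) xs ts ⟩
    ∑ (λ t → count (Bad t) xs) ts             <⟨ *-cancelʳ-< _ _ _ sum< ⟩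
    length xs                                 ∎
... | x , avoids = x , λ t∈ts bad → avoids (any⁺ (λ t → Bad t x) (lose t∈ts bad))

-- Product spaces and random subsets

length-cartesianProductWith : ∀ (f : A → B → C) xs ys →
  length (cartesianProductWith f xs ys) ≡ length xs * length ys
length-cartesianProductWith f []       ys = refl
length-cartesianProductWith f (x ∷ xs) ys = trans (length-++ (map (f x) ys))
  (cong₂ _+_ (length-map (f x) ys) (length-cartesianProductWith f xs ys))

vectors : List A → (k : ℕ) → List (Vec A k)
vectors xs zero    = [] ∷ []
vectors xs (suc k) = cartesianProductWith _∷_ xs (vectors xs k)

length-vectors : ∀ (xs : List A) k → length (vectors xs k) ≡ length xs ^ k
length-vectors xs zero    = refl
length-vectors xs (suc k) = trans (length-cartesianProductWith _∷_ xs (vectors xs k))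
  (cong (length xs *_) (length-vectors xs k))

∈-vectors : ∀ {xs : List A} → (∀ x → x ∈ xs) → (v : Vec A k) → v ∈ vectors xs k
∈-vectors every []      = here refl
∈-vectors every (x ∷ v) = ∈-cartesianProductWith⁺ _∷_ (every x) (∈-vectors every v)

count-vectors-∷ : ∀ (P : Vec A (suc k) → Bool) xs →
  count P (vectors xs (suc k)) ≡ ∑ (λ x → count (P ∘ (x ∷_)) (vectors xs k)) xs
count-vectors-∷ {k = k} P xs = ∑-cartesianProductWith (𝟙 ∘ P) _∷_ xs (vectors xs k)

count-all : ∀ (P : A → Bool) xs k → count (all P ∘ toList) (vectors xs k) ≡ count P xs ^ k
count-all P xs zero    = refl
count-all P xs (suc k) = begin
  count (all P ∘ toList) (vectors xs (suc k))
    ≡⟨ count-vectors-∷ (all P ∘ toList) xs ⟩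
  ∑ (λ x → count (λ v → P x ∧ all P (toList v)) (vectors xs k)) xs
    ≡⟨ ∑-cong xs (λ x → count-∧ˡ (P x) (all P ∘ toList) (vectors xs k)) ⟩
  ∑ (λ x → 𝟙 (P x) * count (all P ∘ toList) (vectors xs k)) xs
    ≡⟨ ∑-*ʳ _ (𝟙 ∘ P) xs ⟩
  count P xs * count (all P ∘ toList) (vectors xs k)
    ≡⟨ cong (count P xs *_) (count-all P xs k) ⟩
  count P xs * count P xs ^ k ∎
  where open ≡-Reasoning

coins : ℕ → List Bool
coins m = true ∷ replicate m false

randomSubsets : ℕ → (n : ℕ) → List (Subset n)
randomSubsets m = vectors (coins m)

length-randomSubsets : ∀ m n → length (randomSubsets m n) ≡ suc m ^ n
length-randomSubsets m n = trans (length-vectors (coins m) n)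
  (cong (λ l → suc l ^ n) (length-replicate m))

count-randomSubsets-∷ : ∀ m (P : Subset (suc n) → Bool) →
  count P (randomSubsets m (suc n)) ≡
  count (P ∘ (true ∷_)) (randomSubsets m n) + m * count (P ∘ (false ∷_)) (randomSubsets m n)
count-randomSubsets-∷ {n} m P = trans (count-vectors-∷ P (coins m))
  (cong (count (P ∘ (true ∷_)) (randomSubsets m n) +_)
    (∑-replicate (λ c → count (P ∘ (c ∷_)) (randomSubsets m n)) m false))

infix 4 _⊆ᵇ_
_⊆ᵇ_ : Subset n → Subset n → Bool
S ⊆ᵇ Q = does (S ⊆? Q)

count-⊇ : ∀ m (S : Subset n) →
  count (S ⊆ᵇ_) (randomSubsets m n) * suc m ^ ∣ S ∣ ≡ suc m ^ n
count-⊇ m []          = refl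
count-⊇ {suc n} m (false ∷ S) = begin
  count ((false ∷ S) ⊆ᵇ_) (randomSubsets m (suc n)) * suc m ^ ∣ S ∣
    ≡⟨ cong (_* suc m ^ ∣ S ∣) (count-randomSubsets-∷ m ((false ∷ S) ⊆ᵇ_)) ⟩
  (c + m * c) * suc m ^ ∣ S ∣   ≡⟨ factor c m (suc m ^ ∣ S ∣) ⟩
  suc m * (c * suc m ^ ∣ S ∣)   ≡⟨ cong (suc m *_) (count-⊇ m S) ⟩
  suc m * suc m ^ n             ∎
  where
  open ≡-Reasoning
  c : ℕ
  c = count (S ⊆ᵇ_) (randomSubsets m n)
  factor : ∀ c m x → (c + m * c) * x ≡ (1 + m) * (c * x)
  factor = solve-∀
count-⊇ {suc n} m (true ∷ S) = begin
  count ((true ∷ S) ⊆ᵇ_) (randomSubsets m (suc n)) * (suc m * suc m ^ ∣ S ∣)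
    ≡⟨ cong (_* (suc m * suc m ^ ∣ S ∣)) (count-randomSubsets-∷ m ((true ∷ S) ⊆ᵇ_)) ⟩
  (c + m * ∑ (const 0) (randomSubsets m n)) * (suc m * suc m ^ ∣ S ∣)
    ≡⟨ cong (λ z → (c + m * z) * (suc m * suc m ^ ∣ S ∣)) (∑-zero (randomSubsets m n)) ⟩
  (c + m * 0) * (suc m * suc m ^ ∣ S ∣)   ≡⟨ factor c m (suc m ^ ∣ S ∣) ⟩
  suc m * (c * suc m ^ ∣ S ∣)             ≡⟨ cong (suc m *_) (count-⊇ m S) ⟩
  suc m * suc m ^ n                       ∎
  where
  open ≡-Reasoning
  c : ℕ
  c = count (S ⊆ᵇ_) (randomSubsets m n)
  factor : ∀ c m x → (c + m * 0) * ((1 + m) * x) ≡ (1 + m) * (c * x)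
  factor = solve-∀

T-does⁻ : ∀ {P : Set} (d : Dec P) → T (does d) → P
T-does⁻ (yes p) _ = p

T-does⁺ : ∀ {P : Set} (d : Dec P) → P → T (does d)
T-does⁺ d p = Equivalence.from T-≡ (dec-true d p)

∪-lub : ∀ {p q r : Subset n} → p ⊆ r → q ⊆ r → p ∪ q ⊆ r
∪-lub {p = p} {q} p⊆r q⊆r x∈p∪q = [ p⊆r , q⊆r ]′ (x∈p∪q⁻ p q x∈p∪q)

x∈p⇒⁅x⁆⊆p : ∀ {x : Fin n} {p} → x ∈ₛ p → ⁅ x ⁆ ⊆ p
x∈p⇒⁅x⁆⊆p {x = x} {p} x∈p y∈⁅x⁆ = subst (_∈ₛ p) (sym (x∈⁅y⁆⇒x≡y x y∈⁅x⁆)) x∈p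

∣⁅x⁆∪p∣≡1+∣p∣ : ∀ {x : Fin n} {p} → x ∉ p → ∣ ⁅ x ⁆ ∪ p ∣ ≡ suc ∣ p ∣
∣⁅x⁆∪p∣≡1+∣p∣ {x = zero}  {true ∷ p}  x∉p = ⊥-elim (x∉p Vec.here)
∣⁅x⁆∪p∣≡1+∣p∣ {x = zero}  {false ∷ p} _   = cong (suc ∘ ∣_∣) (∪-identityˡ p)
∣⁅x⁆∪p∣≡1+∣p∣ {x = suc x} {true ∷ p}  x∉p = cong suc (∣⁅x⁆∪p∣≡1+∣p∣ (x∉p ∘ Vec.there))
∣⁅x⁆∪p∣≡1+∣p∣ {x = suc x} {false ∷ p} x∉p = ∣⁅x⁆∪p∣≡1+∣p∣ (x∉p ∘ Vec.there)

elements : (W : Subset n) → Vec (Fin n) ∣ W ∣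
elements []          = []
elements (true ∷ W)  = zero ∷ Vec.map suc (elements W)
elements (false ∷ W) = Vec.map suc (elements W)

private
  ∈-toList-map⁺ : ∀ {x : Fin n} (v : Vec (Fin n) k) → x ∈ toList v → suc x ∈ toList (Vec.map suc v)
  ∈-toList-map⁺ v x∈v = subst (_ ∈_) (sym (toList-map suc v)) (∈-map⁺ suc x∈v)

  ∈-toList-map⁻ : ∀ {y : Fin (suc n)} (v : Vec (Fin n) k) → y ∈ toList (Vec.map suc v) →
    ∃ λ x → x ∈ toList v × y ≡ suc x
  ∈-toList-map⁻ v y∈ = ∈-map⁻ suc (subst (_ ∈_) (toList-map suc v) y∈)

∈-elements⁺ : ∀ (W : Subset n) {x} → x ∈ₛ W → x ∈ toList (elements W)
∈-elements⁺ (true ∷ W)  Vec.here        = here refl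
∈-elements⁺ (true ∷ W)  (Vec.there x∈W) = there (∈-toList-map⁺ (elements W) (∈-elements⁺ W x∈W))
∈-elements⁺ (false ∷ W) (Vec.there x∈W) = ∈-toList-map⁺ (elements W) (∈-elements⁺ W x∈W)

∈-elements⁻ : ∀ (W : Subset n) {x} → x ∈ toList (elements W) → x ∈ₛ W
∈-elements⁻ (true ∷ W) (here refl) = Vec.here
∈-elements⁻ (true ∷ W) (there x∈) with ∈-toList-map⁻ (elements W) x∈
... | _ , x∈W , refl = Vec.there (∈-elements⁻ W x∈W)
∈-elements⁻ (false ∷ W) x∈ with ∈-toList-map⁻ (elements W) x∈
... | _ , x∈W , refl = Vec.there (∈-elements⁻ W x∈W)

T-not⇒¬T : ∀ {b} → T (not b) → ¬ T b
T-not⇒¬T {false} _ ()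

∉-∪ : ∀ {x : Fin n} {p q} → x ∉ p → x ∉ q → x ∉ p ∪ q
∉-∪ {p = p} {q} x∉p x∉q = [ x∉p , x∉q ]′ ∘ x∈p∪q⁻ p q

∉-pair : ∀ {u v w : Fin n} {W} → u ∉ W → v ∉ W → w ∈ₛ W → w ∉ ⁅ u ⁆ ∪ ⁅ v ⁆
∉-pair u∉W v∉W w∈W = ∉-∪ (x≢y⇒x∉⁅y⁆ λ { refl → u∉W w∈W }) (x≢y⇒x∉⁅y⁆ λ { refl → v∉W w∈W })

-- u ∷ v ∷ ws encodes the witness ({u, v}, set of entries of ws).
IsWitnessTuple : Vec (Fin n) (2 + k) → Set
IsWitnessTuple (u ∷ v ∷ ws) = u ∉ ⁅ v ⁆ × All (_∉ ⁅ u ⁆ ∪ ⁅ v ⁆) (toList ws)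

isWitnessTuple? : Decidable (IsWitnessTuple {n} {k})
isWitnessTuple? (u ∷ v ∷ ws) = ¬? (u ∈? ⁅ v ⁆) ×-dec all? (λ w → ¬? (w ∈? ⁅ u ⁆ ∪ ⁅ v ⁆)) (toList ws)

infix 4 _∈ᵇ_
_∈ᵇ_ : Fin n → Subset n → Bool
x ∈ᵇ Q = does (x ∈? Q)

separatesᵇ : Vec (Fin n) (2 + k) → Subset n → Bool
separatesᵇ (u ∷ v ∷ ws) Q = (⁅ u ⁆ ∪ ⁅ v ⁆ ⊆ᵇ Q) ∧ not (any (_∈ᵇ Q) (toList ws))

separatesᵇ⇒Separates : ∀ {u v} (W : Subset n) Q →
  T (separatesᵇ (u ∷ v ∷ elements W) Q) → Separates Q u v W
separatesᵇ⇒Separates {u = u} {v} W Q sep =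
  pair⊆Q (x∈p∪q⁺ (inj₁ (x∈⁅x⁆ u))) , pair⊆Q (x∈p∪q⁺ (inj₂ (x∈⁅x⁆ v))) , outside
  where
  parts = Equivalence.to T-∧ sep
  pair⊆Q : ⁅ u ⁆ ∪ ⁅ v ⁆ ⊆ Q
  pair⊆Q = T-does⁻ (⁅ u ⁆ ∪ ⁅ v ⁆ ⊆? Q) (proj₁ parts)
  outside : ∀ w → w ∈ₛ W → w ∉ Q
  outside w w∈W w∈Q = T-not⇒¬T (proj₂ parts)
    (any⁺ _ (lose (∈-elements⁺ W w∈W) (T-does⁺ (w ∈? Q) w∈Q)))

scheme-from-tuples : (𝒬 : List (Subset n)) →
  (∀ {t : Vec (Fin n) (2 + k)} → IsWitnessTuple t → Any (T ∘ separatesᵇ t) 𝒬) → IsQueryScheme k 𝒬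
scheme-from-tuples 𝒬 separated u v W (u≢v , refl , u∉W , v∉W) =
  Any.map (separatesᵇ⇒Separates W _)
    (separated (x≢y⇒x∉⁅y⁆ u≢v , All.tabulate (∉-pair u∉W v∉W ∘ ∈-elements⁻ W)))

-- Separation by a single random subset

count-⊇-of-size : ∀ m (S : Subset n) {e} → ∣ S ∣ ≡ e →
  count (S ⊆ᵇ_) (randomSubsets m n) * suc m ^ e ≡ suc m ^ n
count-⊇-of-size m S refl = count-⊇ m S

𝟙-pair≤ : ∀ (u v : Fin n) (ws : Vec (Fin n) k) Q →
  𝟙 (⁅ u ⁆ ∪ ⁅ v ⁆ ⊆ᵇ Q) ≤
  𝟙 (separatesᵇ (u ∷ v ∷ ws) Q) + ∑ (λ w → 𝟙 (⁅ w ⁆ ∪ (⁅ u ⁆ ∪ ⁅ v ⁆) ⊆ᵇ Q)) (toList ws)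
𝟙-pair≤ u v ws Q with ⁅ u ⁆ ∪ ⁅ v ⁆ ⊆ᵇ Q in pair⊆Q | any (_∈ᵇ Q) (toList ws) in hit
... | false | _     = z≤n
... | true  | false = s≤s z≤n
... | true  | true  = begin
  1                                   ≡⟨ cong 𝟙 (sym hit) ⟩
  𝟙 (any (_∈ᵇ Q) (toList ws))         ≤⟨ 𝟙-any≤∑ (_∈ᵇ Q) (toList ws) ⟩
  ∑ (λ w → 𝟙 (w ∈ᵇ Q)) (toList ws)    ≤⟨ ∑-mono-≤ (toList ws) (λ w → 𝟙-mono-≤ (triple⊆Q w)) ⟩
  ∑ (λ w → 𝟙 (⁅ w ⁆ ∪ (⁅ u ⁆ ∪ ⁅ v ⁆) ⊆ᵇ Q)) (toList ws) ∎
  where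
  open ≤-Reasoning
  triple⊆Q : ∀ w → T (w ∈ᵇ Q) → T (⁅ w ⁆ ∪ (⁅ u ⁆ ∪ ⁅ v ⁆) ⊆ᵇ Q)
  triple⊆Q w w∈Q = T-does⁺ (_ ⊆? Q) (∪-lub (x∈p⇒⁅x⁆⊆p (T-does⁻ (w ∈? Q) w∈Q))
                                            (T-does⁻ (_ ⊆? Q) (subst T (sym pair⊆Q) _)))

count-pair≤ : ∀ m (u v : Fin n) (ws : Vec (Fin n) k) → let R = randomSubsets m n in
  count (⁅ u ⁆ ∪ ⁅ v ⁆ ⊆ᵇ_) R ≤
  count (separatesᵇ (u ∷ v ∷ ws)) R + ∑ (λ w → count (⁅ w ⁆ ∪ (⁅ u ⁆ ∪ ⁅ v ⁆) ⊆ᵇ_) R) (toList ws)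
count-pair≤ {n} m u v ws = begin
  count (⁅ u ⁆ ∪ ⁅ v ⁆ ⊆ᵇ_) R
    ≤⟨ ∑-mono-≤ R (𝟙-pair≤ u v ws) ⟩
  ∑ (λ Q → 𝟙 (separatesᵇ (u ∷ v ∷ ws) Q) + ∑ (λ w → 𝟙 (triple w ⊆ᵇ Q)) (toList ws)) R
    ≡⟨ ∑-+ R ⟩
  count (separatesᵇ (u ∷ v ∷ ws)) R + ∑ (λ Q → ∑ (λ w → 𝟙 (triple w ⊆ᵇ Q)) (toList ws)) R
    ≡⟨ cong (count (separatesᵇ (u ∷ v ∷ ws)) R +_) (∑-comm (λ Q w → 𝟙 (triple w ⊆ᵇ Q)) R (toList ws)) ⟩
  count (separatesᵇ (u ∷ v ∷ ws)) R + ∑ (λ w → count (triple w ⊆ᵇ_) R) (toList ws) ∎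
  where
  open ≤-Reasoning
  R = randomSubsets m n
  triple : Fin n → Subset n
  triple w = ⁅ w ⁆ ∪ (⁅ u ⁆ ∪ ⁅ v ⁆)

-- Bonferroni: P[Q separates] ≥ P[u, v ∈ Q] − Σ_{w ∈ ws} P[u, v, w ∈ Q].
separation-count : ∀ m (t : Vec (Fin n) (2 + k)) → IsWitnessTuple t →
  suc m * suc m ^ n ≤ count (separatesᵇ t) (randomSubsets m n) * suc m ^ 3 + k * suc m ^ n
separation-count {n} {k} m (u ∷ v ∷ ws) (u∉⁅v⁆ , ws∉pair) = begin
  suc m * M                                       ≡⟨ cong (suc m *_) (sym (count-⊇-of-size m pair pair-size)) ⟩
  suc m * (count (pair ⊆ᵇ_) R * suc m ^ 2)        ≡⟨ cube (count (pair ⊆ᵇ_) R) (suc m) ⟩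
  count (pair ⊆ᵇ_) R * suc m ^ 3                  ≤⟨ *-monoˡ-≤ (suc m ^ 3) (count-pair≤ m u v ws) ⟩
  (c + ∑ (λ w → count (triple w ⊆ᵇ_) R) ws′) * suc m ^ 3
    ≡⟨ *-distribʳ-+ (suc m ^ 3) c _ ⟩
  c * suc m ^ 3 + ∑ (λ w → count (triple w ⊆ᵇ_) R) ws′ * suc m ^ 3
    ≤⟨ +-monoʳ-≤ (c * suc m ^ 3) (∑-≤-length _ (suc m ^ 3) M ws′ λ {w} w∈ws →
         ≤-reflexive (count-⊇-of-size m (triple w) (triple-size w∈ws))) ⟩
  c * suc m ^ 3 + length ws′ * M                  ≡⟨ cong (λ l → c * suc m ^ 3 + l * M) (length-toList ws) ⟩
  c * suc m ^ 3 + k * M                           ∎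
  where
  open ≤-Reasoning
  R = randomSubsets m n
  M = suc m ^ n
  c = count (separatesᵇ (u ∷ v ∷ ws)) R
  ws′ = toList ws
  pair = ⁅ u ⁆ ∪ ⁅ v ⁆
  triple : Fin n → Subset n
  triple w = ⁅ w ⁆ ∪ pair
  pair-size : ∣ pair ∣ ≡ 2
  pair-size = trans (∣⁅x⁆∪p∣≡1+∣p∣ u∉⁅v⁆) (cong suc (∣⁅x⁆∣≡1 v))
  triple-size : ∀ {w} → w ∈ ws′ → ∣ triple w ∣ ≡ 3
  triple-size w∈ws = trans (∣⁅x⁆∪p∣≡1+∣p∣ (All.lookup ws∉pair w∈ws)) (cong suc pair-size)
  cube : ∀ c x → x * (c * (x * (x * 1))) ≡ c * (x * (x * (x * 1)))
  cube = solve-∀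

separation-probability : ∀ {m p} → suc m ≡ 2 * p → (t : Vec (Fin n) (2 + p)) → IsWitnessTuple t →
  suc m ^ n ≤ count (separatesᵇ t) (randomSubsets m n) * (8 * p ^ 2)
separation-probability {p = zero} ()
separation-probability {n} {m} {p@(suc _)} 1+m≡2p t wit =
  *-cancelˡ-≤ p (+-cancelʳ-≤ (p * M) (p * M) _ (begin
    p * M + p * M                  ≡⟨ double p M ⟩
    2 * p * M                      ≡⟨ cong (_* M) (sym 1+m≡2p) ⟩
    suc m * M                      ≤⟨ separation-count m t wit ⟩
    c * suc m ^ 3 + p * M          ≡⟨ cong (λ x → c * x ^ 3 + p * M) 1+m≡2p ⟩
    c * (2 * p) ^ 3 + p * M        ≡⟨ cong (_+ p * M) (eight c p) ⟩
    p * (c * (8 * p ^ 2)) + p * M  ∎))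
  where
  open ≤-Reasoning
  M = suc m ^ n
  c = count (separatesᵇ t) (randomSubsets m n)
  double : ∀ p M → p * M + p * M ≡ 2 * p * M
  double = solve-∀
  eight : ∀ c p → c * (2 * p * (2 * p * (2 * p * 1))) ≡ p * (c * (8 * (p * (p * 1))))
  eight = solve-∀

-- Amplification and the union bound

¬all-not⇒any : ∀ (P : A → Bool) xs → ¬ T (all (not ∘ P) xs) → Any (T ∘ P) xs
¬all-not⇒any P []       none = ⊥-elim (none _)
¬all-not⇒any P (x ∷ xs) none with P x in Px
... | true  = here (subst T (sym Px) _)
... | false = there (¬all-not⇒any P xs none)

count-all-miss : ∀ (P : A → Bool) xs K τ → 1 < K → length xs ≤ count P xs * K →
  count (all (not ∘ P) ∘ toList) (vectors xs (K * τ)) * 2 ^ τ ≤ length (vectors xs (K * τ))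
count-all-miss P xs K τ 1<K often = begin
  count (all (not ∘ P) ∘ toList) (vectors xs (K * τ)) * 2 ^ τ
    ≡⟨ cong (_* 2 ^ τ) (count-all (not ∘ P) xs (K * τ)) ⟩
  miss ^ (K * τ) * 2 ^ τ         ≡⟨ cong (_* 2 ^ τ) (sym (^-*-assoc miss K τ)) ⟩
  (miss ^ K) ^ τ * 2 ^ τ         ≤⟨ ^-mono-*-≤ τ (halving-power K 1<K miss-rate) ⟩
  (length xs ^ K) ^ τ            ≡⟨ ^-*-assoc (length xs) K τ ⟩
  length xs ^ (K * τ)            ≡⟨ sym (length-vectors xs (K * τ)) ⟩
  length (vectors xs (K * τ))    ∎
  where
  open ≤-Reasoning
  miss = count (not ∘ P) xs
  miss-rate : miss * K + length xs ≤ length xs * K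
  miss-rate = begin
    miss * K + length xs                ≤⟨ +-monoʳ-≤ (miss * K) often ⟩
    miss * K + count P xs * K           ≡⟨ sym (*-distribʳ-+ K miss (count P xs)) ⟩
    (miss + count P xs) * K             ≡⟨ cong (_* K) (count-not P xs) ⟩
    length xs * K                       ∎

random-query-scheme : ∀ n p τ → 1 ≤ p → n ^ (2 + p) < 2 ^ τ →
  ∃ λ (F : Vec (Subset n) (8 * p ^ 2 * τ)) → IsQueryScheme p (toList F)
random-query-scheme n p@(suc q) τ _ N<2^τ = F , scheme-from-tuples (toList F) separated
  where
  m = q + p
  1+m≡2p : suc m ≡ 2 * p
  1+m≡2p = cong (p +_) (sym (+-identityʳ p))
  R = randomSubsets m n
  K = 8 * p ^ 2
  1<K : 1 < K
  1<K = ≤-trans (s≤s (s≤s z≤n)) (m≤m*n 8 (p ^ 2) {{m^n≢0 p 2}})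
  families = vectors R (K * τ)
  nonempty : 0 < length families
  nonempty = subst (0 <_) (sym (length-vectors R (K * τ)))
    (m^n>0 (length R) {{subst NonZero (sym (length-randomSubsets m n)) (m^n≢0 (suc m) n)}} (K * τ))
  candidates = vectors (allFin n) (2 + p)
  tuples = filter isWitnessTuple? candidates
  few : length tuples < 2 ^ τ
  few = ≤-<-trans (length-filter isWitnessTuple? candidates) (subst (_< 2 ^ τ) (sym length-candidates) N<2^τ)
    where
    length-candidates : length candidates ≡ n ^ (2 + p)
    length-candidates = trans (length-vectors (allFin n) (2 + p))
      (cong (_^ (2 + p)) (length-tabulate {n = n} id))
  Miss : Vec (Fin n) (2 + p) → Vec (Subset n) (K * τ) → Bool
  Miss t F = all (not ∘ separatesᵇ t) (toList F)
  rare : ∀ {t} → t ∈ tuples → count (Miss t) families * 2 ^ τ ≤ length families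
  rare {t} t∈tuples = count-all-miss (separatesᵇ t) R K τ 1<K
    (subst (_≤ count (separatesᵇ t) R * K) (sym (length-randomSubsets m n))
      (separation-probability 1+m≡2p t (proj₂ (∈-filter⁻ isWitnessTuple? {xs = candidates} t∈tuples))))
  avoiding = ∃-avoiding Miss tuples families (2 ^ τ) nonempty few rare
  F = proj₁ avoiding
  separated : ∀ {t} → IsWitnessTuple t → Any (T ∘ separatesᵇ t) (toList F)
  separated {t} wit = ¬all-not⇒any (separatesᵇ t) (toList F)
    (proj₂ avoiding (∈-filter⁺ isWitnessTuple? (∈-vectors ∈-allFin t) wit))

pairs : (n : ℕ) → List (Subset n)
pairs n = cartesianProductWith (λ u v → ⁅ u ⁆ ∪ ⁅ v ⁆) (allFin n) (allFin n)

length-pairs : ∀ n → length (pairs n) ≡ n * n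
length-pairs n = trans (length-cartesianProductWith _ (allFin n) (allFin n))
  (cong₂ _*_ (length-tabulate {n = n} _) (length-tabulate {n = n} _))

pairs-isQueryScheme : ∀ {n} p → IsQueryScheme p (pairs n)
pairs-isQueryScheme p u v W (_ , _ , u∉W , v∉W) =
  lose (∈-cartesianProductWith⁺ _ (∈-allFin u) (∈-allFin v))
    ( x∈p∪q⁺ (inj₁ (x∈⁅x⁆ u)) , x∈p∪q⁺ (inj₂ (x∈⁅x⁆ v))
    , λ _ → ∉-pair u∉W v∉W)

scaled-bound : ∀ {ℓ y a p n} → ℓ ≤ y → 2 * p ^ a ≤ n ^ a → 2 ^ ℓ * p ^ (a * y) ≤ n ^ (a * y)
scaled-bound {ℓ} {y} {a} {p} {n} ℓ≤y 2p^a≤n^a = begin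
  2 ^ ℓ * p ^ (a * y)     ≤⟨ *-monoˡ-≤ (p ^ (a * y)) (^-monoʳ-≤ 2 ℓ≤y) ⟩
  2 ^ y * p ^ (a * y)     ≡⟨ cong (2 ^ y *_) (sym (^-*-assoc p a y)) ⟩
  2 ^ y * (p ^ a) ^ y     ≤⟨ ^-mono-*-≤ y 2p^a≤n^a ⟩
  (n ^ a) ^ y             ≡⟨ ^-*-assoc n a y ⟩
  n ^ (a * y)             ∎
  where open ≤-Reasoning

2p^p≤n^p : ∀ {p n} → 1 ≤ p → p + 2 ≤ n → 2 * p ^ p ≤ n ^ p
2p^p≤n^p {p@(suc _)} {n} _ p+2≤n = begin
  2 * p ^ p         ≤⟨ *-cancelʳ-≤ _ _ p (begin
      2 * p ^ p * p           ≡⟨ rearrange (p ^ p) p ⟩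
      p ^ p * (2 * p)         ≤⟨ *-monoʳ-≤ (p ^ p) (≤-trans (m≤m+n (2 * p) p) (≤-reflexive (triple p))) ⟩
      p ^ p * (p + p * 2)     ≤⟨ bernoulli p 2 p ⟩
      (p + 2) ^ p * p         ∎) ⟩
  (p + 2) ^ p       ≤⟨ ^-monoˡ-≤ p p+2≤n ⟩
  n ^ p             ∎
  where
  open ≤-Reasoning
  rearrange : ∀ x p → 2 * x * p ≡ x * (2 * p)
  rearrange = solve-∀
  triple : ∀ p → 2 * p + p ≡ p + p * 2
  triple = solve-∀

-- For n ≥ 2p use 2 ≤ (n/p)^144; otherwise n² ≤ 144 p² and 2 ≤ (1 + 2/p)^p ≤ (n/p)^p.
pairs-bound : ∀ {n p} → 1 ≤ p → p + 2 ≤ n → n * n ≤ p ^ 3 →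
  2 ^ (n * n) * p ^ (144 * p ^ 3) ≤ n ^ (144 * p ^ 3)
pairs-bound {n} {p} 1≤p p+2≤n n²≤p³ with 2 * p ≤? n
... | yes 2p≤n = scaled-bound {y = p ^ 3} {a = 144} n²≤p³ (begin
  2 * p ^ 144          ≤⟨ *-monoˡ-≤ (p ^ 144) (m≤m*n 2 (2 ^ 143) {{m^n≢0 2 143}}) ⟩
  2 ^ 144 * p ^ 144    ≡⟨ sym (^-distribʳ-* 2 p 144) ⟩
  (2 * p) ^ 144        ≤⟨ ^-monoˡ-≤ 144 2p≤n ⟩
  n ^ 144              ∎)
  where open ≤-Reasoning
... | no  2p≰n = subst (λ e → 2 ^ (n * n) * p ^ e ≤ n ^ e) (exponent p)
  (scaled-bound {y = 144 * p ^ 2} {a = p} n²≤144p² (2p^p≤n^p 1≤p p+2≤n))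
  where
  open ≤-Reasoning
  n≤2p : n ≤ 2 * p
  n≤2p = ≤-trans (n≤1+n n) (≰⇒> 2p≰n)
  exponent : ∀ p → p * (144 * (p * (p * 1))) ≡ 144 * (p * (p * (p * 1)))
  exponent = solve-∀
  square : ∀ p → 2 * p * (2 * p) ≡ 4 * (p * (p * 1))
  square = solve-∀
  n²≤144p² : n * n ≤ 144 * p ^ 2
  n²≤144p² = begin
    n * n               ≤⟨ *-mono-≤ n≤2p n≤2p ⟩
    2 * p * (2 * p)     ≡⟨ square p ⟩
    4 * p ^ 2           ≤⟨ *-monoˡ-≤ (p ^ 2) (m≤m+n 4 140) ⟩
    144 * p ^ 2         ∎

-- 2^(8p²τ) ≤ (n^(p+2))^(16p²) ≤ n^(48p³), and p^(144p³) ≤ n^(96p³) because p³ ≤ n².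
random-bound : ∀ {n p τ} → 1 ≤ p → 2 ≤ n → p ^ 3 ≤ n * n → 2 ^ τ ≤ 2 * n ^ (2 + p) →
  2 ^ (8 * p ^ 2 * τ) * p ^ (144 * p ^ 3) ≤ n ^ (144 * p ^ 3)
random-bound {n} {p} {τ} 1≤p 2≤n p³≤n² 2^τ≤2N = begin
  2 ^ (K * τ) * p ^ (144 * x)                   ≡⟨ cong₂ (λ a b → 2 ^ a * p ^ b) (*-comm K τ) (split x) ⟩
  2 ^ (τ * K) * p ^ (3 * e)                     ≡⟨ sym (cong₂ _*_ (^-*-assoc 2 τ K) (^-*-assoc p 3 e)) ⟩
  (2 ^ τ) ^ K * (p ^ 3) ^ e                     ≤⟨ *-mono-≤ (^-monoˡ-≤ K 2^τ≤N²) (^-monoˡ-≤ e p³≤n²) ⟩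
  (N * N) ^ K * (n * n) ^ e                     ≡⟨ cong₂ _*_ (^-distribʳ-* N N K) (^-distribʳ-* n n e) ⟩
  N ^ K * N ^ K * (n ^ e * n ^ e)               ≡⟨ cong₂ _*_ (sym (^-distribˡ-+-* N K K)) (sym (^-distribˡ-+-* n e e)) ⟩
  N ^ (K + K) * n ^ (e + e)                     ≡⟨ cong (_* n ^ (e + e)) (^-*-assoc n (2 + p) (K + K)) ⟩
  n ^ ((2 + p) * (K + K)) * n ^ (e + e)         ≡⟨ sym (^-distribˡ-+-* n ((2 + p) * (K + K)) (e + e)) ⟩
  n ^ ((2 + p) * (K + K) + (e + e))             ≤⟨ ^-monoʳ-≤ n {{nonZero}} exponent≤ ⟩
  n ^ (144 * x)                                 ∎
  where
  open ≤-Reasoning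
  K = 8 * p ^ 2
  x = p ^ 3
  e = 48 * x
  N = n ^ (2 + p)
  nonZero : NonZero n
  nonZero = >-nonZero (≤-trans (s≤s z≤n) 2≤n)
  split : ∀ x → 144 * x ≡ 3 * (48 * x)
  split = solve-∀
  2^τ≤N² : 2 ^ τ ≤ N * N
  2^τ≤N² = ≤-trans 2^τ≤2N (*-monoˡ-≤ N (≤-trans 2≤n (m≤m*n n (n ^ (1 + p)) {{m^n≢0 n (1 + p) {{nonZero}}}})))
  exponent≤ : (2 + p) * (K + K) + (e + e) ≤ 144 * x
  exponent≤ = begin
    (2 + p) * (K + K) + (e + e)           ≡⟨ regroup p ⟩
    16 * p ^ 2 * (2 + p) + 96 * x         ≤⟨ +-monoˡ-≤ (96 * x) (*-monoʳ-≤ (16 * p ^ 2) 2+p≤3p) ⟩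
    16 * p ^ 2 * (3 * p) + 96 * x         ≡⟨ collect p ⟩
    144 * x                               ∎
    where
    2+p≤3p : 2 + p ≤ 3 * p
    2+p≤3p = ≤-trans (+-monoˡ-≤ p (*-monoʳ-≤ 2 1≤p)) (≤-reflexive (three p))
      where
      three : ∀ p → 2 * p + p ≡ 3 * p
      three = solve-∀
    regroup : ∀ p → (2 + p) * (8 * (p * (p * 1)) + 8 * (p * (p * 1)))
                      + (48 * (p * (p * (p * 1))) + 48 * (p * (p * (p * 1))))
                    ≡ 16 * (p * (p * 1)) * (2 + p) + 96 * (p * (p * (p * 1)))
    regroup = solve-∀
    collect : ∀ p → 16 * (p * (p * 1)) * (3 * p) + 96 * (p * (p * (p * 1))) ≡ 144 * (p * (p * (p * 1)))
    collect = solve-∀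

BoundedQueryScheme : ℕ → (n p : ℕ) → Set
BoundedQueryScheme C n p = Σ (List (Subset n)) λ 𝒬 → IsQueryScheme p 𝒬 ×
  (2 ^ length 𝒬 * p ^ (C * p ^ 3) ≤ n ^ (C * p ^ 3))

pairs-scheme : ∀ {n p} → 1 ≤ p → p + 2 ≤ n → n * n ≤ p ^ 3 → BoundedQueryScheme 144 n p
pairs-scheme {n} {p} 1≤p p+2≤n n²≤p³ = pairs n , pairs-isQueryScheme p ,
  subst (λ ℓ → 2 ^ ℓ * p ^ (144 * p ^ 3) ≤ n ^ (144 * p ^ 3)) (sym (length-pairs n))
    (pairs-bound 1≤p p+2≤n n²≤p³)

random-scheme : ∀ {n p} → 1 ≤ p → p + 2 ≤ n → p ^ 3 < n * n → BoundedQueryScheme 144 n p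
random-scheme {n} {p} 1≤p p+2≤n p³<n² =
  let τ , N<2^τ , 2^τ≤2N = power-of-two-between (n ^ (2 + p)) (m^n>0 n {{nonZero}} (2 + p))
      F , isScheme = random-query-scheme n p τ 1≤p N<2^τ
  in toList F , isScheme ,
     subst (λ ℓ → 2 ^ ℓ * p ^ (144 * p ^ 3) ≤ n ^ (144 * p ^ 3)) (sym (length-toList F))
       (random-bound 1≤p 2≤n (<⇒≤ p³<n²) 2^τ≤2N)
  where
  2≤n : 2 ≤ n
  2≤n = ≤-trans (m≤n+m 2 p) p+2≤n
  nonZero : NonZero n
  nonZero = >-nonZero (≤-trans (s≤s z≤n) 2≤n)

lemma3 : ∃ λ (C : ℕ) → (n p : ℕ) → 1 ≤ p → p + 2 ≤ n →
    Σ (List (Subset n)) λ 𝒬 → IsQueryScheme p 𝒬 ×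
      (2 ^ length 𝒬 * p ^ (C * p ^ 3) ≤ n ^ (C * p ^ 3))
lemma3 = 144 , scheme
  where
  scheme : (n p : ℕ) → 1 ≤ p → p + 2 ≤ n → BoundedQueryScheme 144 n p
  scheme n p 1≤p p+2≤n with n * n ≤? p ^ 3
  ... | yes n²≤p³ = pairs-scheme 1≤p p+2≤n n²≤p³
  ... | no  n²≰p³ = random-scheme 1≤p p+2≤n (≰⇒> n²≰p³)
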